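{- Consider the Kierstead-Trotter algorithm run on any online sequence $v_1,\dots,v_n$ of unit intervals. Then the intervals that receive level $2$ (i.e., the graph $G_{2,2}(n)$) are colored by First-Fit using at most two colors of the palette $P_2$.
   Context: Online unit interval coloring: closed intervals of length one on the real line are revealed one at a time, $v_i$ being the $i$th interval; $G=(V,E)$ is the interval graph whose vertices are the intervals, two intervals being adjacent iff they intersect. Each interval must be assigned a color upon arrival, before the next is revealed, so that intersecting intervals get different colors. For a graph $H$ and vertex $v$ of $H$, $\omega(H,v)$ denotes the size of a maximum clique of $H$ containing $v$. Kierstead-Trotter algorithm: every interval $v$ has a level $\ell(v)$, initialized to $1$. For integers $x\le y$ let $V_{x,y}(i)=\{v_j : j\le i,\ x\le \ell(v_j)\le y\}$ and $G_{x,y}(i)$ the subgraph of $G$ induced by $V_{x,y}(i)$. When $v_i$ is revealed: (Step 1) set $\ell(v_i)$ to the smallest positive integer $j$ with $\omega(G_{1,j}(i),v_i)\le j$ (where $v_i$ currently has level $1$ and so belongs to $G_{1,j}(i)$); (Step 2) color $v_i$ by First-Fit on $G_{\ell(v_i),\ell(v_i)}(i)$ using the palette $P_{\ell(v_i)}$, i.e., give $v_i$ the first color in a fixed ordering of $P_{\ell(v_i)}$ not already used by an earlier interval of the same level intersecting $v_i$. The palettes $P_1,P_2,\dots$ are pairwise disjoint sets of colors.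
   Formalization: The unit intervals have rational endpoints rather than arbitrary endpoints on the real line. -}

module Defs where

open import Data.Nat using (ℕ; _<_; _≤_)
open import Data.Rational as ℚ using (ℚ; 1ℚ)
open import Data.List using (List; length)
open import Data.List.Membership.Propositional using (_∈_)
open import Data.List.Relation.Unary.All using (All)
open import Data.List.Relation.Unary.Unique.Propositional using (Unique)
open import Data.Product using (Σ; ∃; _×_)
open import Data.Sum using (_⊎_)
open import Relation.Binary.PropositionalEquality using (_≡_; _≢_)
open import Relation.Nullary using (¬_)

-- A unit interval is represented by its left endpoint a : ℚ;
-- it is the closed interval [a, a + 1].
InUnitInterval : ℚ → ℚ → Set
InUnitInterval a x = a ℚ.≤ x × x ℚ.≤ a ℚ.+ 1ℚ

Intersect : ℚ → ℚ → Set
Intersect a b = ∃ λ x → InUnitInterval a x × InUnitInterval b x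

module KT (v : ℕ → ℚ) (ℓ : ℕ → ℕ) where
  -- v k : the (k+1)-th revealed interval (0-based indices), ℓ k : its level.

  -- S (a list of distinct indices) is a clique of G_{1,j}(i) containing v_i,
  -- where v_i is regarded as having level 1 (Step 1 of the algorithm).
  IsClique : ℕ → ℕ → List ℕ → Set
  IsClique i j S =
    Unique S ×
    i ∈ S ×
    All (λ k → k ≡ i ⊎ (k < i × 1 ≤ ℓ k × ℓ k ≤ j)) S ×
    (∀ {a b} → a ∈ S → b ∈ S → Intersect (v a) (v b))

  ωAtMost : ℕ → ℕ → Set
  ωAtMost i j = ∀ S → IsClique i j S → length S ≤ j

  LevelSpec : ℕ → Set
  LevelSpec i =
    1 ≤ ℓ i × ωAtMost i (ℓ i) × (∀ j → 1 ≤ j → j < ℓ i → ¬ ωAtMost i j)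

  -- Step 2: First-Fit within level ℓ i.  Palette P_L is {L} × ℕ ordered by
  -- the second component; c i is the position in P_{ℓ i} of v_i's colour.
  FirstFitSpec : (ℕ → ℕ) → ℕ → Set
  FirstFitSpec c i =
    (∀ k → k < i → ℓ k ≡ ℓ i → Intersect (v k) (v i) → c k ≢ c i) ×
    (∀ m → m < c i →
       ∃ λ k → k < i × ℓ k ≡ ℓ i × Intersect (v k) (v i) × c k ≡ m)

-- (ℓ , c) is the run of the Kierstead–Trotter algorithm on v_1,…,v_n
-- (indices 0 … n-1).  Since each step is determined by the previous ones,
-- this determines ℓ and c on indices < n uniquely.
KTRun : (n : ℕ) (v : ℕ → ℚ) (ℓ c : ℕ → ℕ) → Set
KTRun n v ℓ c = ∀ i → i < n → KT.LevelSpec v ℓ i × KT.FirstFitSpec v ℓ c i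

{-# OPTIONS --safe #-}
module Submission where

-- A level-2 interval v with colour at least 2 has, by First-Fit, two earlier level-2
-- neighbours (those coloured 0 and 1), and, since level 1 was rejected for it, an earlier
-- level-1 neighbour.  Two of these three unit intervals lie on the same side of v, hence
-- meet each other, and together with v they form a triangle in G_{1,2}, contradicting
-- ω(G_{1,2}, v) ≤ 2.

open import Defs
open import Data.Nat using (ℕ; suc; _<_; _≤_; z≤n; s≤s; _<?_)
open import Data.Nat.Properties using (≮⇒≥; ≤-reflexive; >⇒≢; <-irrefl; <⇒≤; m≤n⇒m≤1+n)
open import Data.Rational as ℚ using (ℚ; 1ℚ)
open import Data.Rational.Properties
  using (≤-refl; ≤-trans; ≤-total; +-monoʳ-≤; +-monoˡ-≤; +-identityʳ; nonNegative⁻¹)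
open import Data.Product using (∃₂; _×_; _,_)
open import Data.Sum using (_⊎_; inj₁; inj₂)
open import Data.Empty using (⊥; ⊥-elim)
open import Data.List using ([]; _∷_)
open import Data.List.Relation.Unary.All using (All; []; _∷_)
open import Data.List.Relation.Unary.AllPairs using ([]; _∷_)
open import Data.List.Relation.Unary.Unique.Propositional using (Unique)
open import Data.List.Relation.Unary.Any using (here; there)
open import Data.List.Membership.Propositional using (_∈_)
open import Relation.Binary.PropositionalEquality using (_≡_; _≢_; refl; sym; trans; subst)
open import Relation.Nullary using (¬_; yes; no)

p≤p+1 : ∀ p → p ℚ.≤ p ℚ.+ 1ℚ
p≤p+1 p = subst (ℚ._≤ p ℚ.+ 1ℚ) (+-identityʳ p) (+-monoʳ-≤ p (nonNegative⁻¹ 1ℚ))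

Intersect-sym : ∀ {a b} → Intersect a b → Intersect b a
Intersect-sym (x , a∋x , b∋x) = x , b∋x , a∋x

Intersect⇒≤+1 : ∀ {a b} → Intersect a b → a ℚ.≤ b ℚ.+ 1ℚ
Intersect⇒≤+1 (x , (a≤x , _) , (_ , x≤b+1)) = ≤-trans a≤x x≤b+1

≤∧≤+1⇒Intersect : ∀ {a b} → a ℚ.≤ b → b ℚ.≤ a ℚ.+ 1ℚ → Intersect a b
≤∧≤+1⇒Intersect {b = b} a≤b b≤a+1 = b , (a≤b , b≤a+1) , (≤-refl , p≤p+1 b)

Intersect-refl : ∀ a → Intersect a a
Intersect-refl a = ≤∧≤+1⇒Intersect ≤-refl (p≤p+1 a)

left-neighbours-intersect : ∀ {a b c} → a ℚ.≤ c → b ℚ.≤ c →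
  Intersect a c → Intersect b c → Intersect a b
left-neighbours-intersect {a} {b} a≤c b≤c a∩c b∩c with ≤-total a b
... | inj₁ a≤b = ≤∧≤+1⇒Intersect a≤b (≤-trans b≤c (Intersect⇒≤+1 (Intersect-sym a∩c)))
... | inj₂ b≤a = Intersect-sym
  (≤∧≤+1⇒Intersect b≤a (≤-trans a≤c (Intersect⇒≤+1 (Intersect-sym b∩c))))

right-neighbours-intersect : ∀ {a b c} → c ℚ.≤ a → c ℚ.≤ b →
  Intersect a c → Intersect b c → Intersect a b
right-neighbours-intersect {a} {b} c≤a c≤b a∩c b∩c with ≤-total a b
... | inj₁ a≤b = ≤∧≤+1⇒Intersect a≤b (≤-trans (Intersect⇒≤+1 b∩c) (+-monoˡ-≤ 1ℚ c≤a))
... | inj₂ b≤a = Intersect-sym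
  (≤∧≤+1⇒Intersect b≤a (≤-trans (Intersect⇒≤+1 a∩c) (+-monoˡ-≤ 1ℚ c≤b)))

-- Pigeonhole on the side of c on which each of a, b, d starts.
neighbours-pigeonhole : ∀ {a b d c} → Intersect a c → Intersect b c → Intersect d c →
  Intersect a b ⊎ Intersect a d ⊎ Intersect b d
neighbours-pigeonhole {a} {b} {d} {c} a∩c b∩c d∩c =
  sides (≤-total a c) (≤-total b c) (≤-total d c)
  where
  sides : a ℚ.≤ c ⊎ c ℚ.≤ a → b ℚ.≤ c ⊎ c ℚ.≤ b → d ℚ.≤ c ⊎ c ℚ.≤ d →
    Intersect a b ⊎ Intersect a d ⊎ Intersect b d
  sides (inj₁ a≤c) (inj₁ b≤c) _ = inj₁ (left-neighbours-intersect a≤c b≤c a∩c b∩c)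
  sides (inj₂ c≤a) (inj₂ c≤b) _ = inj₁ (right-neighbours-intersect c≤a c≤b a∩c b∩c)
  sides (inj₁ a≤c) (inj₂ _) (inj₁ d≤c) = inj₂ (inj₁ (left-neighbours-intersect a≤c d≤c a∩c d∩c))
  sides (inj₂ c≤a) (inj₁ _) (inj₂ c≤d) = inj₂ (inj₁ (right-neighbours-intersect c≤a c≤d a∩c d∩c))
  sides (inj₁ _) (inj₂ c≤b) (inj₂ c≤d) = inj₂ (inj₂ (right-neighbours-intersect c≤b c≤d b∩c d∩c))
  sides (inj₂ _) (inj₁ b≤c) (inj₁ d≤c) = inj₂ (inj₂ (left-neighbours-intersect b≤c d≤c b∩c d∩c))

module _ (v : ℕ → ℚ) (ℓ : ℕ → ℕ) (i : ℕ) where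
  open KT v ℓ

  Neighbour : ℕ → ℕ → Set
  Neighbour j k = k < i × 1 ≤ ℓ k × ℓ k ≤ j × Intersect (v k) (v i)

  triangle-isClique : ∀ {j p q} → Neighbour j p → Neighbour j q → p ≢ q →
    Intersect (v p) (v q) → IsClique i j (i ∷ p ∷ q ∷ [])
  triangle-isClique {j} {p} {q} (p<i , 1≤ℓp , ℓp≤j , p∩i) (q<i , 1≤ℓq , ℓq≤j , q∩i) p≢q p∩q =
    unique , here refl , levels , pairwise
    where
    unique : Unique (i ∷ p ∷ q ∷ [])
    unique = (>⇒≢ p<i ∷ >⇒≢ q<i ∷ []) ∷ (p≢q ∷ []) ∷ [] ∷ []
    levels : All (λ k → k ≡ i ⊎ (k < i × 1 ≤ ℓ k × ℓ k ≤ j)) (i ∷ p ∷ q ∷ [])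
    levels = inj₁ refl ∷ inj₂ (p<i , 1≤ℓp , ℓp≤j) ∷ inj₂ (q<i , 1≤ℓq , ℓq≤j) ∷ []
    pairwise : ∀ {a b} → a ∈ i ∷ p ∷ q ∷ [] → b ∈ i ∷ p ∷ q ∷ [] → Intersect (v a) (v b)
    pairwise (here refl)                 (here refl)                 = Intersect-refl (v i)
    pairwise (here refl)                 (there (here refl))         = Intersect-sym p∩i
    pairwise (here refl)                 (there (there (here refl))) = Intersect-sym q∩i
    pairwise (there (here refl))         (here refl)                 = p∩i
    pairwise (there (here refl))         (there (here refl))         = Intersect-refl (v p)
    pairwise (there (here refl))         (there (there (here refl))) = p∩q
    pairwise (there (there (here refl))) (here refl)                 = q∩i
    pairwise (there (there (here refl))) (there (here refl))         = Intersect-sym p∩q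
    pairwise (there (there (here refl))) (there (there (here refl))) = Intersect-refl (v q)

  ωAtMost2⇒¬three-neighbours : ∀ {p q r} → ωAtMost i 2 →
    Neighbour 2 p → Neighbour 2 q → Neighbour 2 r → p ≢ q → p ≢ r → q ≢ r → ⊥
  ωAtMost2⇒¬three-neighbours ω np@(_ , _ , _ , p∩i) nq@(_ , _ , _ , q∩i) nr@(_ , _ , _ , r∩i)
    p≢q p≢r q≢r with neighbours-pigeonhole p∩i q∩i r∩i
  ... | inj₁ p∩q        = <-irrefl refl (ω _ (triangle-isClique np nq p≢q p∩q))
  ... | inj₂ (inj₁ p∩r) = <-irrefl refl (ω _ (triangle-isClique np nr p≢r p∩r))
  ... | inj₂ (inj₂ q∩r) = <-irrefl refl (ω _ (triangle-isClique nq nr q≢r q∩r))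

  no-neighbour⇒ωAtMost1 : (∀ k → ¬ Neighbour 1 k) → ωAtMost i 1
  no-neighbour⇒ωAtMost1 none []      _ = z≤n
  no-neighbour⇒ωAtMost1 none (_ ∷ []) _ = s≤s z≤n
  no-neighbour⇒ωAtMost1 none (x ∷ y ∷ _) (((x≢y ∷ _) ∷ _) , i∈S , x-ok ∷ y-ok ∷ _ , pairwise)
    with x-ok | y-ok
  ... | inj₂ (x<i , 1≤ℓx , ℓx≤1) | _ =
    ⊥-elim (none x (x<i , 1≤ℓx , ℓx≤1 , pairwise (here refl) i∈S))
  ... | inj₁ _ | inj₂ (y<i , 1≤ℓy , ℓy≤1) =
    ⊥-elim (none y (y<i , 1≤ℓy , ℓy≤1 , pairwise (there (here refl)) i∈S))
  ... | inj₁ x≡i | inj₁ y≡i = ⊥-elim (x≢y (trans x≡i (sym y≡i)))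

<2⇒≡0⊎≡1 : ∀ {m} → m < 2 → m ≡ 0 ⊎ m ≡ 1
<2⇒≡0⊎≡1 {0} _ = inj₁ refl
<2⇒≡0⊎≡1 {1} _ = inj₂ refl
<2⇒≡0⊎≡1 {suc (suc _)} (s≤s (s≤s ()))

level2-colour<2 : ∀ {n v ℓ c i} → KTRun n v ℓ c → i < n → ℓ i ≡ 2 → c i < 2
level2-colour<2 {v = v} {ℓ} {c} {i} run i<n ℓi≡2 with c i <? 2 | run i i<n
... | yes ci<2 | _ = ci<2
... | no ci≮2 | (_ , ωℓi , minimal) , (_ , firstFit) =
  ⊥-elim (minimal 1 (s≤s z≤n) (subst (1 <_) (sym ℓi≡2) (s≤s (s≤s z≤n)))
    (no-neighbour⇒ωAtMost1 v ℓ i no-level1-neighbour))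
  where
  2≤ci : 2 ≤ c i
  2≤ci = ≮⇒≥ ci≮2

  level2-neighbour : ∀ {k} → k < i → ℓ k ≡ ℓ i → Intersect (v k) (v i) → Neighbour v ℓ i 2 k
  level2-neighbour {k} k<i ℓk≡ℓi k∩i =
    k<i , subst (1 ≤_) (sym ℓk≡2) (s≤s z≤n) , ≤-reflexive ℓk≡2 , k∩i
    where
    ℓk≡2 : ℓ k ≡ 2
    ℓk≡2 = trans ℓk≡ℓi ℓi≡2

  no-level1-neighbour : ∀ u → ¬ Neighbour v ℓ i 1 u
  no-level1-neighbour u (u<i , 1≤ℓu , ℓu≤1 , u∩i)
    with firstFit 0 (<⇒≤ 2≤ci) | firstFit 1 2≤ci
  ... | k₀ , k₀<i , ℓk₀≡ℓi , k₀∩i , ck₀≡0 | k₁ , k₁<i , ℓk₁≡ℓi , k₁∩i , ck₁≡1 =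
    ωAtMost2⇒¬three-neighbours v ℓ i (subst (KT.ωAtMost v ℓ i) ℓi≡2 ωℓi)
      (u<i , 1≤ℓu , m≤n⇒m≤1+n ℓu≤1 , u∩i)
      (level2-neighbour k₀<i ℓk₀≡ℓi k₀∩i) (level2-neighbour k₁<i ℓk₁≡ℓi k₁∩i)
      (u≢ ℓk₀≡ℓi) (u≢ ℓk₁≡ℓi) k₀≢k₁
    where
    u≢ : ∀ {k} → ℓ k ≡ ℓ i → u ≢ k
    u≢ ℓk≡ℓi refl = <-irrefl refl (subst (_≤ 1) (trans ℓk≡ℓi ℓi≡2) ℓu≤1)
    k₀≢k₁ : k₀ ≢ k₁
    k₀≢k₁ refl with trans (sym ck₀≡0) ck₁≡1
    ... | ()

lemma2 : (n : ℕ) (v : ℕ → ℚ) (ℓ c : ℕ → ℕ) → KTRun n v ℓ c →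
    ∃₂ λ a b → ∀ i → i < n → ℓ i ≡ 2 → c i ≡ a ⊎ c i ≡ b
lemma2 n v ℓ c run = 0 , 1 , λ i i<n ℓi≡2 → <2⇒≡0⊎≡1 (level2-colour<2 run i<n ℓi≡2)
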